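{- Let $F=\langle W,R,\{S_x\}_{x\in W}\rangle$ be any $\mathbf{ILS}$-frame. Then the schema $\mathbf{J5}$: $\Diamond A\rhd A$ is valid in $F$ if and only if for all $x,y,z\in W$, if $xRy$ and $yRz$ then $yS_x\{z\}$.
   Context: Formulas are built from propositional variables, $\top,\bot$, $\neg,\land,\lor,\to$, unary $\Box$ and binary $\rhd$; $\Diamond A$ abbreviates $\neg\Box\neg A$. An $\mathbf{ILS}$-frame is a triple $\langle W,R,\{S_x\}_{x\in W}\rangle$ with $W$ nonempty, $R$ transitive and conversely well-founded on $W$, each $S_x\subseteq W\times(\mathcal P(W)\setminus\{\emptyset\})$ such that $yS_xV$ implies $xRy$, and (monotonicity) $yS_xV$ and $V\subseteq U$ imply $yS_xU$. Satisfaction: usual Boolean clauses, $x\Vdash\Box A$ iff $y\Vdash A$ for all $y$ with $xRy$, and $x\Vdash A\rhd B$ iff for every $y$ with $xRy$ and $y\Vdash A$ there is $V\subseteq W$ with $yS_xV$ and $z\Vdash B$ for all $z\in V$. A schema is valid in a frame if every instance holds at every point under every satisfaction relation. -}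

module Defs where

open import Level using (Lift)
import Level
open import Data.Nat using (ℕ)
open import Data.Product using (Σ; ∃; _×_; _,_)
open import Data.Sum using (_⊎_)
open import Data.Unit using (⊤)
open import Data.Empty using (⊥)
open import Relation.Binary.PropositionalEquality using (_≡_)
open import Induction.WellFounded using (WellFounded)

data Fm : Set where
  var  : ℕ → Fm
  ⊤'   : Fm
  ⊥'   : Fm
  ¬'_  : Fm → Fm
  _∧'_ : Fm → Fm → Fm
  _∨'_ : Fm → Fm → Fm
  _→'_ : Fm → Fm → Fm
  □_   : Fm → Fm
  _▷_  : Fm → Fm → Fm

◇_ : Fm → Fm
◇ A = ¬' (□ (¬' A))

Subset : Set → Set₁
Subset W = W → Set

_⊆_ : {W : Set} → Subset W → Subset W → Set
V ⊆ U = ∀ w → V w → U w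

NonEmpty : {W : Set} → Subset W → Set
NonEmpty V = ∃ λ w → V w

｛_｝ : {W : Set} → W → Subset W
｛ z ｝ = λ w → w ≡ z

record ILSFrame : Set₁ where
  field
    W        : Set
    inhabited : W
    R        : W → W → Set
    R-trans  : ∀ {x y z} → R x y → R y z → R x z
    -- converse well-foundedness: no infinite ascending R-chains
    R-cwf    : WellFounded (λ y x → R x y)
    S        : W → W → Subset W → Set
    S-nonempty : ∀ {x y V} → S x y V → NonEmpty V
    S-R      : ∀ {x y V} → S x y V → R x y
    S-mono   : ∀ {x y V U} → S x y V → V ⊆ U → S x y U

module _ (F : ILSFrame) where
  open ILSFrame F

  Valuation : Set₁
  Valuation = ℕ → W → Set

  -- Satisfaction lives in Set₁ since the ▷ clause quantifies over subsets.
  Sat : Valuation → W → Fm → Set₁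
  Sat v x (var p)  = Lift (Level.suc Level.zero) (v p x)
  Sat v x ⊤'       = Lift (Level.suc Level.zero) ⊤
  Sat v x ⊥'       = Lift (Level.suc Level.zero) ⊥
  Sat v x (¬' A)   = Sat v x A → Lift (Level.suc Level.zero) ⊥
  Sat v x (A ∧' B) = Sat v x A × Sat v x B
  Sat v x (A ∨' B) = Sat v x A ⊎ Sat v x B
  Sat v x (A →' B) = Sat v x A → Sat v x B
  Sat v x (□ A)    = ∀ y → R x y → Sat v y A
  Sat v x (A ▷ B)  = ∀ y → R x y → Sat v y A →
                       Σ (Subset W) λ V → S x y V × (∀ z → V z → Sat v z B)

  J5Valid : Set₁
  J5Valid = ∀ (A : Fm) (v : Valuation) (x : W) → Sat v x ((◇ A) ▷ A)

  J5Cond : Set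
  J5Cond = ∀ x y z → R x y → R y z → S x y ｛ z ｝

-- (⇒) No classical reasoning is needed.  Given xRy and yRz, interpret a
--     variable p as "being the point z".  Then y ⊩ ◇p (z witnesses it),
--     so the instance ◇p ▷ p at x yields a set V with y S_x V on which p
--     holds, i.e. V ⊆ {z}; monotonicity of S_x gives y S_x {z}.
--
-- (⇐) Given x R y with y ⊩ ◇A, excluded middle extracts a successor z of
--     y with z ⊩ A (◇A is ¬□¬A, so the witness only exists classically).
--     The frame condition gives y S_x {z}, and every point of {z} forces A.
module Submission where

open import Defs
open import Level using (zero; suc; lift; lower)
open import Axiom.ExcludedMiddle using (ExcludedMiddle)
open import Function.Bundles using (_⇔_; mk⇔)
open import Data.Product using (Σ; _×_; _,_)
open import Data.Empty using (⊥-elim)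
open import Relation.Nullary using (yes; no)
open import Relation.Binary.PropositionalEquality using (_≡_; refl; subst; sym)

module _ (F : ILSFrame) where
  open ILSFrame F

  ◇-intro : ∀ {v A y} z → R y z → Sat F v z A → Sat F v y (◇ A)
  ◇-intro z ryz zA notA = notA z ryz zA

  ◇-elim : ExcludedMiddle (suc zero) →
           ∀ {v A y} → Sat F v y (◇ A) → Σ W λ z → R y z × Sat F v z A
  ◇-elim lem {v} {A} {y} yA with lem {Σ W λ z → R y z × Sat F v z A}
  ... | yes witness = witness
  ... | no none     = ⊥-elim (lower (yA λ z ryz zA → lift (none (z , ryz , zA))))

  singleton-forces : ∀ {v B} z → Sat F v z B → ∀ w → ｛ z ｝ w → Sat F v w B
  singleton-forces {v} {B} z zB w w≡z = subst (λ u → Sat F v u B) (sym w≡z) zB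

  pointValuation : W → Valuation F
  pointValuation z _ w = w ≡ z

  J5Valid⇒J5Cond : J5Valid F → J5Cond F
  J5Valid⇒J5Cond valid x y z rxy ryz
    with valid (var 0) (pointValuation z) x y rxy
               (◇-intro {v = pointValuation z} {A = var 0} z ryz (lift refl))
  ... | V , ySV , V⊩p = S-mono ySV V⊆｛z｝
    where
      V⊆｛z｝ : V ⊆ ｛ z ｝
      V⊆｛z｝ w Vw = lower (V⊩p w Vw)

  J5Cond⇒J5Valid : ExcludedMiddle (suc zero) → J5Cond F → J5Valid F
  J5Cond⇒J5Valid lem cond A v x y rxy y⊩◇A with ◇-elim lem y⊩◇A
  ... | z , ryz , z⊩A = ｛ z ｝ , cond x y z rxy ryz , singleton-forces z z⊩A

proposition3p19 : ExcludedMiddle (suc zero) → (F : ILSFrame) → J5Valid F ⇔ J5Cond F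
proposition3p19 lem F = mk⇔ (J5Valid⇒J5Cond F) (J5Cond⇒J5Valid F lem)
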